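{- Let $A$ be a nonempty set and let $Q\subseteq\mathrm{Rel}(A)$ be homogeneous. Then $\langle Q\rangle_{KA,\bigcap}=\mathrm{sInv}\,\mathrm{Aut}\,Q$.
   Context: $\mathrm{Rel}^{(m)}(A)$ is the set of subsets of $A^m$ and $\mathrm{Rel}(A)=\bigcup_{m\ge1}\mathrm{Rel}^{(m)}(A)$. For a permutation $g$ of $A$, $g[\varrho]=\{(g(a_1),\dots,g(a_m))\mid (a_1,\dots,a_m)\in\varrho\}$. $\mathrm{Aut}\,Q$ is the set of permutations $g$ of $A$ with $g[\varrho]=\varrho$ for all $\varrho\in Q$; $\mathrm{sInv}\,G$ is the set of $\varrho\in\mathrm{Rel}(A)$ with $g[\varrho]=\varrho$ for all $g\in G$. A logical operation on relations is an operation of the form $L_\varphi(\varrho_1,\dots,\varrho_n)=\{(a_1,\dots,a_m)\in A^m\mid (A;\varrho_1,\dots,\varrho_n)\models\varphi(a_1,\dots,a_m)\}$, where $n\ge0$ and $\varphi(P_1,\dots,P_n;x_1,\dots,x_m)$ is a first-order formula (with equality) in predicate symbols $P_i$ of the arities of $\varrho_i$ whose free variables are among $x_1,\dots,x_m$. A set $R\subseteq\mathrm{Rel}(A)$ is $\bigcap$-closed if $A^m\in R$ for all $m\ge1$ and $\bigcap S\in R$ for every $m$ and every $S\subseteq R\cap\mathrm{Rel}^{(m)}(A)$ (with $\bigcap\emptyset=A^m$). $\langle Q\rangle_{KA,\bigcap}$ is the least set of relations containing $Q$ that is closed under all logical operations and is $\bigcap$-closed. A partial automorphism of $Q$ is a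 bijection $f:A_1\to A_2$ between subsets of $A$ such that for all $\sigma\in Q$ of arity $m$ and all $a_1,\dots,a_m\in A_1$: $(a_1,\dots,a_m)\in\sigma\iff(f(a_1),\dots,f(a_m))\in\sigma$. $Q$ is homogeneous if every finite partial automorphism of $Q$ extends to an element of $\mathrm{Aut}\,Q$. -}

module Defs where

open import Level using (Level; _⊔_; Lift) renaming (suc to lsuc)
open import Data.Nat using (ℕ) renaming (suc to sucℕ)
open import Data.Fin using (Fin; zero; suc)
open import Data.Product using (Σ; ∃; _×_; _,_)
open import Data.Sum using (_⊎_)
open import Data.Empty using (⊥)
open import Data.Unit using (⊤)
open import Relation.Nullary using (¬_)
open import Relation.Binary.PropositionalEquality using (_≡_)
open import Function.Bundles using (_⇔_; _↔_; Inverse)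
open import Function.Definitions using (Injective)

private
  variable
    a q : Level

Tuple : Set a → ℕ → Set a
Tuple A m = Fin m → A

Rel : Set a → ℕ → Set (lsuc a)
Rel {a} A m = Tuple A m → Set a

_≐_ : {A : Set a} {m : ℕ} → Rel A m → Rel A m → Set a
ρ ≐ σ = ∀ t → ρ t ⇔ σ t

-- A set Q ⊆ Rel(A) = ⋃_{m ≥ 1} Rel^(m)(A): arity (sucℕ m) with m : ℕ
RelSet : Set a → (q : Level) → Set (lsuc a ⊔ lsuc q)
RelSet {a} A q = (m : ℕ) → Rel A (sucℕ m) → Set q

Perm : Set a → Set a
Perm A = A ↔ A

image : {A : Set a} {m : ℕ} → Perm A → Rel A m → Rel A m
image g ρ t = ∃ λ s → ρ s × (∀ j → Inverse.to g (s j) ≡ t j)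

Aut : {A : Set a} → RelSet A q → Perm A → Set (lsuc a ⊔ q)
Aut Q g = ∀ m σ → Q m σ → image g σ ≐ σ

sInv : {A : Set a} {ℓ : Level} → (Perm A → Set ℓ) → (m : ℕ) → Rel A (sucℕ m) → Set (a ⊔ ℓ)
sInv G m ρ = ∀ g → G g → image g ρ ≐ ρ

-- First-order formulas (with equality) in n predicate symbols P_i of arity
-- sucℕ (ar i), with variables among Fin k (de Bruijn: quantifiers bind variable zero).
data Formula (n : ℕ) (ar : Fin n → ℕ) : ℕ → Set where
  tt ff : ∀ {k} → Formula n ar k
  _≈_   : ∀ {k} → Fin k → Fin k → Formula n ar k
  atom  : ∀ {k} (i : Fin n) → (Fin (sucℕ (ar i)) → Fin k) → Formula n ar k
  ¬'_   : ∀ {k} → Formula n ar k → Formula n ar k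
  _∧'_ _∨'_ _⇒'_ : ∀ {k} → Formula n ar k → Formula n ar k → Formula n ar k
  ∀' ∃' : ∀ {k} → Formula n ar (sucℕ k) → Formula n ar k

extend : {A : Set a} {k : ℕ} → A → (Fin k → A) → Fin (sucℕ k) → A
extend x env zero    = x
extend x env (suc j) = env j

⟦_⟧ : {A : Set a} {n : ℕ} {ar : Fin n → ℕ} {k : ℕ} → Formula n ar k →
      ((i : Fin n) → Rel A (sucℕ (ar i))) → (Fin k → A) → Set a
⟦ tt ⟧      ρs env = Lift _ ⊤
⟦ ff ⟧      ρs env = Lift _ ⊥
⟦ x ≈ y ⟧   ρs env = env x ≡ env y
⟦ atom i xs ⟧ ρs env = ρs i (λ j → env (xs j))
⟦ ¬' φ ⟧    ρs env = ¬ ⟦ φ ⟧ ρs env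
⟦ φ ∧' ψ ⟧  ρs env = ⟦ φ ⟧ ρs env × ⟦ ψ ⟧ ρs env
⟦ φ ∨' ψ ⟧  ρs env = ⟦ φ ⟧ ρs env ⊎ ⟦ ψ ⟧ ρs env
⟦ φ ⇒' ψ ⟧  ρs env = ⟦ φ ⟧ ρs env → ⟦ ψ ⟧ ρs env
⟦_⟧ {A = A} (∀' φ) ρs env = (x : A) → ⟦ φ ⟧ ρs (extend x env)
⟦_⟧ {A = A} (∃' φ) ρs env = Σ A λ x → ⟦ φ ⟧ ρs (extend x env)

L : {A : Set a} {n : ℕ} {ar : Fin n → ℕ} {m : ℕ} → Formula n ar (sucℕ m) →
    ((i : Fin n) → Rel A (sucℕ (ar i))) → Rel A (sucℕ m)
L φ ρs t = ⟦ φ ⟧ ρs t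

data ⟨_⟩KA∩ {A : Set a} (Q : RelSet A q) : (m : ℕ) → Rel A (sucℕ m) → Set (lsuc a ⊔ q) where
  base  : ∀ {m ρ} → Q m ρ → ⟨ Q ⟩KA∩ m ρ
  logic : ∀ {m} (n : ℕ) (ar : Fin n → ℕ) (ρs : (i : Fin n) → Rel A (sucℕ (ar i))) →
          (∀ i → ⟨ Q ⟩KA∩ (ar i) (ρs i)) → (φ : Formula n ar (sucℕ m)) →
          ⟨ Q ⟩KA∩ m (L φ ρs)
  full  : ∀ m → ⟨ Q ⟩KA∩ m (λ _ → Lift a ⊤)
  inter : ∀ {m} (I : Set a) (S : I → Rel A (sucℕ m)) → (∀ i → ⟨ Q ⟩KA∩ m (S i)) →
          ⟨ Q ⟩KA∩ m (λ t → ∀ i → S i t)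
  ext   : ∀ {m ρ σ} → ⟨ Q ⟩KA∩ m ρ → ρ ≐ σ → ⟨ Q ⟩KA∩ m σ

-- A finite partial bijection f : A₁ → A₂, listed by its graph {(as i , bs i) | i < k}
-- with as, bs injective (A₁ = range as, A₂ = range bs, f (as i) = bs i);
-- it is a partial automorphism of Q if it preserves and reflects every σ ∈ Q.
IsPartialAut : {A : Set a} → RelSet A q → {k : ℕ} → (Fin k → A) → (Fin k → A) → Set (lsuc a ⊔ q)
IsPartialAut {a} {q} {A} Q {k} as bs =
  Injective _≡_ _≡_ as × Injective _≡_ _≡_ bs ×
  (∀ m σ → Q m σ → (ix : Fin (sucℕ m) → Fin k) → σ (λ j → as (ix j)) ⇔ σ (λ j → bs (ix j)))

Homogeneous : {A : Set a} → RelSet A q → Set (lsuc a ⊔ q)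
Homogeneous {A = A} Q = ∀ (k : ℕ) (as bs : Fin k → A) → IsPartialAut Q as bs →
  Σ (Perm A) λ g → Aut Q g × (∀ i → Inverse.to g (as i) ≡ bs i)

{-# OPTIONS --safe #-}
-- An automorphism fixes every relation of Q, hence, by induction on formulas and on the
-- closure, every relation of ⟨Q⟩KA∩.  Conversely let ρ be Aut Q-invariant, t ∈ ρ and s ∉ ρ.
-- If no relation of ⟨Q⟩KA∩ contained t but not s, then (⟨Q⟩KA∩ being closed under
-- complement) t and s would satisfy the same equalities and the same Q-atoms, so t i ↦ s i
-- would be a finite partial automorphism; by homogeneity it extends to an automorphism
-- mapping t to s, forcing s ∈ ρ.  So ρ = ⋂_{s ∉ ρ} ⋃_{t ∈ ρ} D(t,s) with D(t,s) ∈ ⟨Q⟩KA∩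
-- separating t from s, and unions are complements of intersections of complements.
module Submission where

open import Defs
open import Level using (Level; _⊔_) renaming (suc to lsuc)
open import Data.Nat using (ℕ; zero; suc)
open import Data.Fin using (Fin; zero; suc)
open import Data.Fin.Properties using (any?)
open import Data.Product using (Σ; ∃; _×_; _,_; proj₁)
open import Data.Product.Function.NonDependent.Propositional using (_×-⇔_)
open import Data.Product.Function.Dependent.Propositional using (Σ-⇔)
open import Data.Sum.Function.Propositional using (_⊎-⇔_)
open import Data.Empty using (⊥-elim)
open import Function using (_∘_; id; _⇔_; mk⇔; Inverse; Injection; Equivalence; Injective)
open import Function.Construct.Composition using (_⇔-∘_)
open import Function.Construct.Identity using (⇔-id)
open import Function.Construct.Symmetry using (⇔-sym)
open import Function.Properties.Inverse using (↔⇒↠; ↔⇒↣)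
open import Function.Related.TypeIsomorphisms using (→-cong-⇔; ¬-cong-⇔)
open import Relation.Binary.Definitions using (DecidableEquality)
open import Relation.Binary.PropositionalEquality using (_≡_; _≗_; refl; sym; trans; cong; module ≡-Reasoning)
open import Relation.Nullary using (¬_; yes; no)
open import Relation.Unary using (∁; ⋃; _∈_; _∉_)
open import Axiom.ExcludedMiddle using (ExcludedMiddle)
open import Axiom.DoubleNegationElimination using (em⇒dne)

private
  variable
    a b q : Level
    A : Set a
    B : Set b
    k m n : ℕ
    ρ : Rel A m

extend-∘ : (f : A → B) {e : Fin k → A} {e' : Fin k → B} {x : A} {y : B} →
           f ∘ e ≗ e' → f x ≡ y → f ∘ extend x e ≗ extend y e'
extend-∘ f f∘e≗e' fx≡y zero    = fx≡y
extend-∘ f f∘e≗e' fx≡y (suc j) = f∘e≗e' j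

module _ {A : Set a} (g : Perm A) where
  open Inverse g
  open Injection (↔⇒↣ g) using (injective)

  -- Quantifying over all t with to ∘ s ≗ t, rather than taking t = to ∘ s, also makes ρ respect
  -- pointwise equality of tuples, which is not automatic without function extensionality.
  Invariant : Rel A m → Set a
  Invariant ρ = ∀ {s t} → to ∘ s ≗ t → ρ s ⇔ ρ t

  image≐⇒respects-≗ : image g ρ ≐ ρ → ∀ {s t} → s ≗ t → ρ s → ρ t
  image≐⇒respects-≗ fixed s≗t ρs with Equivalence.from (fixed _) ρs
  ... | u , ρu , to∘u≗s = Equivalence.to (fixed _) (u , ρu , λ j → trans (to∘u≗s j) (s≗t j))

  image≐⇒invariant : image g ρ ≐ ρ → Invariant ρ
  image≐⇒invariant {ρ = ρ} fixed {s} {t} to∘s≗t =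
    mk⇔ (λ ρs → Equivalence.to (fixed t) (s , ρs , to∘s≗t)) backward
    where
    backward : ρ t → ρ s
    backward ρt with Equivalence.from (fixed t) ρt
    ... | u , ρu , to∘u≗t =
      image≐⇒respects-≗ fixed (λ j → injective (trans (to∘u≗t j) (sym (to∘s≗t j)))) ρu

  invariant⇒image≐ : Invariant ρ → image g ρ ≐ ρ
  invariant⇒image≐ inv t = mk⇔
    (λ { (s , ρs , to∘s≗t) → Equivalence.to (inv to∘s≗t) ρs })
    (λ ρt → from ∘ t , Equivalence.from (inv (strictlyInverseˡ ∘ t)) ρt , strictlyInverseˡ ∘ t)

  ⟦⟧-invariant : {ar : Fin n → ℕ} {ρs : (i : Fin n) → Rel A (suc (ar i))} → (∀ i → Invariant (ρs i)) →
                 (φ : Formula n ar k) {e e' : Fin k → A} → to ∘ e ≗ e' → ⟦ φ ⟧ ρs e ⇔ ⟦ φ ⟧ ρs e'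
  ⟦⟧-invariant inv tt          p = ⇔-id _
  ⟦⟧-invariant inv ff          p = ⇔-id _
  ⟦⟧-invariant inv (x ≈ y)     p = mk⇔ (λ ex≡ey → trans (sym (p x)) (trans (cong to ex≡ey) (p y)))
                                       (λ e'x≡e'y → injective (trans (p x) (trans e'x≡e'y (sym (p y)))))
  ⟦⟧-invariant inv (atom i xs) p = inv i (p ∘ xs)
  ⟦⟧-invariant inv (¬' φ)      p = ¬-cong-⇔ (⟦⟧-invariant inv φ p)
  ⟦⟧-invariant inv (φ ∧' ψ)    p = ⟦⟧-invariant inv φ p ×-⇔ ⟦⟧-invariant inv ψ p
  ⟦⟧-invariant inv (φ ∨' ψ)    p = ⟦⟧-invariant inv φ p ⊎-⇔ ⟦⟧-invariant inv ψ p
  ⟦⟧-invariant inv (φ ⇒' ψ)    p = →-cong-⇔ (⟦⟧-invariant inv φ p) (⟦⟧-invariant inv ψ p)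
  ⟦⟧-invariant inv (∀' φ)      p = mk⇔
    (λ h y → Equivalence.to (⟦⟧-invariant inv φ (extend-∘ to p (strictlyInverseˡ y))) (h (from y)))
    (λ h x → Equivalence.from (⟦⟧-invariant inv φ (extend-∘ to p refl)) (h (to x)))
  ⟦⟧-invariant inv (∃' φ)      p = Σ-⇔ (↔⇒↠ g) (⟦⟧-invariant inv φ (extend-∘ to p refl))

module _ {Q : RelSet A q} (g : Perm A) (aut : Aut Q g) where

  ⟨⟩KA∩-invariant : ⟨ Q ⟩KA∩ m ρ → Invariant g ρ
  ⟨⟩KA∩-invariant (base {m} {σ} Qσ)       = image≐⇒invariant g (aut m σ Qσ)
  ⟨⟩KA∩-invariant (logic n ar ρs ps φ)    = ⟦⟧-invariant g (λ i → ⟨⟩KA∩-invariant (ps i)) φ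
  ⟨⟩KA∩-invariant (full m)              p = ⇔-id _
  ⟨⟩KA∩-invariant (inter I S ps)        p = mk⇔
    (λ Ss i → Equivalence.to   (⟨⟩KA∩-invariant (ps i) p) (Ss i))
    (λ St i → Equivalence.from (⟨⟩KA∩-invariant (ps i) p) (St i))
  ⟨⟩KA∩-invariant (ext ps ρ≐σ)          p = ρ≐σ _ ⇔-∘ (⟨⟩KA∩-invariant ps p ⇔-∘ ⇔-sym (ρ≐σ _))

⟨⟩KA∩⊆sInvAut : {Q : RelSet A q} → ⟨ Q ⟩KA∩ m ρ → sInv (Aut Q) m ρ
⟨⟩KA∩⊆sInvAut ps g aut = invariant⇒image≐ g (⟨⟩KA∩-invariant g aut ps)

module _ {A : Set a} {Q : RelSet A q} where

  ∁-closed : ⟨ Q ⟩KA∩ m ρ → ⟨ Q ⟩KA∩ m (∁ ρ)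
  ∁-closed {m} {ρ} ps = logic 1 (λ _ → m) (λ _ → ρ) (λ _ → ps) (¬' atom zero id)

  ⋃-closed : ExcludedMiddle a → {I : Set a} {S : I → Rel A (suc m)} →
             (∀ i → ⟨ Q ⟩KA∩ m (S i)) → ⟨ Q ⟩KA∩ m (⋃ I S)
  ⋃-closed em ps = ext (∁-closed (inter _ _ (λ i → ∁-closed (ps i))))
    λ t → mk⇔ (λ ¬∀¬ → em⇒dne em λ ∄ → ¬∀¬ λ i Sit → ∄ (i , Sit))
              (λ { (i , Sit) ∀¬ → ∀¬ i Sit })

  record Separator (t s : Tuple A (suc m)) : Set (lsuc a ⊔ q) where
    field
      D        : Rel A (suc m)
      D-closed : ⟨ Q ⟩KA∩ m D
      t∈D      : t ∈ D
      s∉D      : s ∉ D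

  ⟨⟩KA∩-by-separation : ExcludedMiddle a → (∀ {t s} → t ∈ ρ → s ∉ ρ → Separator t s) → ⟨ Q ⟩KA∩ m ρ
  ⟨⟩KA∩-by-separation {ρ = ρ} em separate =
    ext (inter _ Cover λ s → ⋃-closed em λ t → D-closed (sep t s))
        λ x → mk⇔ (λ x∈⋂ → em⇒dne em λ x∉ρ → uncovered (x , x∉ρ) (x∈⋂ (x , x∉ρ)))
                  (λ x∈ρ s → (x , x∈ρ) , t∈D (sep (x , x∈ρ) s))
    where
    open Separator

    sep : (t : ∃ ρ) (s : ∃ (∁ ρ)) → Separator (proj₁ t) (proj₁ s)
    sep (t , t∈ρ) (s , s∉ρ) = separate t∈ρ s∉ρ

    Cover : ∃ (∁ ρ) → Rel A _
    Cover s = ⋃ (∃ ρ) λ t → D (sep t s)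

    uncovered : ∀ s → proj₁ s ∉ Cover s
    uncovered s (t , s∈D) = s∉D (sep t s) s∈D

  Indistinguishable : Tuple A (suc m) → Tuple A (suc m) → Set (lsuc a ⊔ q)
  Indistinguishable {m} t s = ∀ {D : Rel A (suc m)} → ⟨ Q ⟩KA∩ m D → t ∈ D ⇔ s ∈ D

  inseparable⇒indistinguishable : ExcludedMiddle a → {t s : Tuple A (suc m)} →
                                  ¬ Separator t s → Indistinguishable t s
  inseparable⇒indistinguishable em ¬t|s {D} D-closed = mk⇔
    (λ t∈D → em⇒dne em λ s∉D → ¬t|s (record { D-closed = D-closed ; t∈D = t∈D ; s∉D = s∉D }))
    (λ s∈D → em⇒dne em λ t∉D → ¬t|s (record { D-closed = ∁-closed D-closed ; t∈D = t∉D ; s∉D = λ s∉D → s∉D s∈D }))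

record SameAtomicType {A : Set a} (Q : RelSet A q) (t s : Tuple A n) : Set (lsuc a ⊔ q) where
  field
    same-equalities : ∀ i j → t i ≡ t j ⇔ s i ≡ s j
    same-atoms      : ∀ m σ → Q m σ → (ι : Fin (suc m) → Fin n) → σ (t ∘ ι) ⇔ σ (s ∘ ι)

indistinguishable⇒sameAtomicType : {Q : RelSet A q} {t s : Tuple A (suc m)} →
                                   Indistinguishable t s → SameAtomicType Q t s
indistinguishable⇒sameAtomicType indist = record
  { same-equalities = λ i j → indist (logic 0 (λ ()) (λ ()) (λ ()) (i ≈ j))
  ; same-atoms      = λ m σ Qσ ι → indist (logic 1 (λ _ → m) (λ _ → σ) (λ _ → base Qσ) (atom zero ι))
  }

record Representatives {A : Set a} (t : Fin n → A) : Set a where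
  field
    size           : ℕ
    pick           : Fin size → Fin n
    pick-injective : Injective _≡_ _≡_ (t ∘ pick)
    rep            : Fin n → Fin size
    pick-rep       : t ∘ pick ∘ rep ≗ t

representatives : DecidableEquality A → (t : Fin n → A) → Representatives t
representatives {n = zero} _≟_ t =
  record { size = 0 ; pick = λ () ; pick-injective = λ {} ; rep = λ () ; pick-rep = λ () }
representatives {n = suc n} _≟_ t with representatives _≟_ (t ∘ suc)
... | R with any? (λ c → t (suc (Representatives.pick R c)) ≟ t zero)
... | yes (c , e) =
  record { pick = suc ∘ pick ; pick-injective = pick-injective ; rep = rep′ ; pick-rep = pick-rep′ }
  where
  open Representatives R
  rep′ : Fin (suc n) → Fin size
  rep′ zero    = c
  rep′ (suc i) = rep i
  pick-rep′ : t ∘ suc ∘ pick ∘ rep′ ≗ t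
  pick-rep′ zero    = e
  pick-rep′ (suc i) = pick-rep i
... | no ∄ =
  record { pick = pick′ ; pick-injective = pick′-injective ; rep = rep′ ; pick-rep = pick-rep′ }
  where
  open Representatives R
  pick′ : Fin (suc size) → Fin (suc n)
  pick′ zero    = zero
  pick′ (suc c) = suc (pick c)
  pick′-injective : Injective _≡_ _≡_ (t ∘ pick′)
  pick′-injective {zero}  {zero}   _ = refl
  pick′-injective {zero}  {suc c′} e = ⊥-elim (∄ (c′ , sym e))
  pick′-injective {suc c} {zero}   e = ⊥-elim (∄ (c , e))
  pick′-injective {suc c} {suc c′} e = cong suc (pick-injective e)
  rep′ : Fin (suc n) → Fin (suc size)
  rep′ zero    = zero
  rep′ (suc i) = suc (rep i)
  pick-rep′ : t ∘ pick′ ∘ rep′ ≗ t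
  pick-rep′ zero    = refl
  pick-rep′ (suc i) = pick-rep i

-- Homogeneity only applies to injective enumerations, so the partial map t i ↦ s i is
-- given on representatives of the entries of t.
sameAtomicType⇒automorphism : {Q : RelSet A q} → Homogeneous Q → DecidableEquality A →
  {t s : Tuple A n} → SameAtomicType Q t s → Σ (Perm A) λ g → Aut Q g × Inverse.to g ∘ t ≗ s
sameAtomicType⇒automorphism {A = A} {Q = Q} hom _≟_ {t} {s} same =
  let g , aut , g∘t∘pick≗s∘pick = hom size (t ∘ pick) (s ∘ pick) partialAut
  in  g , aut , agree-on-representatives (Inverse.to g) g∘t∘pick≗s∘pick
  where
  open SameAtomicType same
  open Representatives (representatives _≟_ t)

  partialAut : IsPartialAut Q (t ∘ pick) (s ∘ pick)
  partialAut = pick-injective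
             , (λ e → pick-injective (Equivalence.from (same-equalities _ _) e))
             , λ m σ Qσ ix → same-atoms m σ Qσ (pick ∘ ix)

  agree-on-representatives : (f : A → A) → f ∘ t ∘ pick ≗ s ∘ pick → f ∘ t ≗ s
  agree-on-representatives f f∘t∘pick≗s∘pick i = begin
    f (t i)                ≡⟨ cong f (sym (pick-rep i)) ⟩
    f (t (pick (rep i)))   ≡⟨ f∘t∘pick≗s∘pick (rep i) ⟩
    s (pick (rep i))       ≡⟨ Equivalence.to (same-equalities _ _) (pick-rep i) ⟩
    s i                    ∎
    where open ≡-Reasoning

sInvAut⊆⟨⟩KA∩ : (∀ {ℓ} → ExcludedMiddle ℓ) → {Q : RelSet A q} → Homogeneous Q →
                sInv (Aut Q) m ρ → ⟨ Q ⟩KA∩ m ρ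
sInvAut⊆⟨⟩KA∩ {ρ = ρ} em {Q} hom inv = ⟨⟩KA∩-by-separation em separate
  where
  separate : ∀ {t s} → t ∈ ρ → s ∉ ρ → Separator t s
  separate {t} {s} t∈ρ s∉ρ = em⇒dne em λ ¬t|s →
    let same = indistinguishable⇒sameAtomicType (inseparable⇒indistinguishable em ¬t|s)
        g , aut , g∘t≗s = sameAtomicType⇒automorphism hom (λ _ _ → em) same
    in s∉ρ (Equivalence.to (inv g aut s) (t , t∈ρ , g∘t≗s))

lemma2p7 : ∀ {a q : Level} {A : Set a} → (∀ {ℓ} → ExcludedMiddle ℓ) → A →
    (Q : RelSet A q) → Homogeneous Q →
    ∀ (m : ℕ) (ρ : Rel A (suc m)) →
      (⟨ Q ⟩KA∩ m ρ → sInv (Aut Q) m ρ) × (sInv (Aut Q) m ρ → ⟨ Q ⟩KA∩ m ρ)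
-- The argument never needs an element of A.
lemma2p7 em _ Q hom m ρ = ⟨⟩KA∩⊆sInvAut , sInvAut⊆⟨⟩KA∩ em hom
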